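{- Let $N$ be a binary matroid and $a \in E(N)$. If $N \backslash a \cong M(K_{3,3})$, then no element of $N/a$ belongs both to a 2-circuit and to a circuit of odd size of $N/a$.
   Context: $M(K_{3,3})$ is the cycle matroid of the complete bipartite graph $K_{3,3}$. -}

module Defs where

open import Data.Nat using (ℕ; zero; suc; _≤_; _%_)
open import Data.Bool using (Bool; true; false; _xor_; if_then_else_)
open import Data.Fin using (Fin; zero; suc; inject₁; fromℕ; _↑ˡ_; _↑ʳ_; remQuot)
open import Data.Fin.Subset using (Subset; _∈_; _∉_; _⊆_; _∪_; _-_; ∣_∣; Nonempty; inside)
open import Data.Vec using (Vec; []; _∷_; replicate; zipWith; tabulate; lookup)
open import Data.Product using (Σ; ∃; _×_; _,_; proj₁; proj₂)
open import Data.Sum using (_⊎_)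
open import Relation.Binary.PropositionalEquality using (_≡_; _≢_)
open import Relation.Nullary using (¬_)
open import Function using (_∘_; Injective)
open import Level using (0ℓ)

record Matroid (n : ℕ) : Set₁ where
  field
    Circuit : Subset n → Set
    circuit-nonempty : ∀ C → Circuit C → Nonempty C
    circuit-incomparable : ∀ C D → Circuit C → Circuit D → C ⊆ D → C ≡ D
    circuit-elimination : ∀ C D e → Circuit C → Circuit D → C ≢ D →
      e ∈ C → e ∈ D → ∃ λ F → Circuit F × F ⊆ ((C ∪ D) - e)

open Matroid public

-- Binary matroids: circuits are those of a vector matroid over GF(2).
-- GF(2) = Bool with xor as addition; vectors in GF(2)^r = Vec Bool r.

_⊕_ : ∀ {r} → Vec Bool r → Vec Bool r → Vec Bool r
_⊕_ = zipWith _xor_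

zeroV : ∀ {r} → Vec Bool r
zeroV = replicate _ false

sumOver : ∀ {n r} → (Fin n → Vec Bool r) → Subset n → Vec Bool r
sumOver {zero} v [] = zeroV
sumOver {suc n} v (b ∷ X) = (if b then v zero else zeroV) ⊕ sumOver (v ∘ suc) X

-- X is linearly dependent over GF(2): some nontrivial linear
-- combination (i.e. a nonempty subset sum, over GF(2)) vanishes.
Dependent : ∀ {n r} → (Fin n → Vec Bool r) → Subset n → Set
Dependent v X = ∃ λ S → S ⊆ X × Nonempty S × sumOver v S ≡ zeroV

VecCircuit : ∀ {n r} → (Fin n → Vec Bool r) → Subset n → Set
VecCircuit v C = Dependent v C × (∀ D → D ⊆ C → Dependent v D → D ≡ C)

Binary : ∀ {n} → Matroid n → Set
Binary {n} N = ∃ λ r → ∃ λ (v : Fin n → Vec Bool r) →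
  ∀ C → (Circuit N C → VecCircuit v C) × (VecCircuit v C → Circuit N C)

-- Deletion and contraction of a single element a, with ground set
-- E(N) - a represented as subsets of Fin n not containing a.

DelCircuit : ∀ {n} → Matroid n → Fin n → Subset n → Set
DelCircuit N a C = a ∉ C × Circuit N C

ConCircuit : ∀ {n} → Matroid n → Fin n → Subset n → Set
ConCircuit N a D =
  Nonempty D × (∃ λ C → Circuit N C × D ≡ C - a) ×
  (∀ C → Circuit N C → Nonempty (C - a) → (C - a) ⊆ D → (C - a) ≡ D)

record Graph : Set where
  field
    V E : ℕ
    ends : Fin E → Fin V × Fin V

open Graph public

Joins : (G : Graph) → Fin (E G) → Fin (V G) → Fin (V G) → Set
Joins G e u w = (ends G e ≡ (u , w)) ⊎ (ends G e ≡ (w , u))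

-- C is the edge set of a cycle: a closed walk w₀ f₀ w₁ … f_{k-1} w_k = w₀,
-- k ≥ 1, with w₀ … w_{k-1} distinct and f₀ … f_{k-1} distinct.
IsCycleEdgeSet : (G : Graph) → Subset (E G) → Set
IsCycleEdgeSet G C =
  ∃ λ k → 1 ≤ k × ∃ λ (w : Fin (suc k) → Fin (V G)) → ∃ λ (f : Fin k → Fin (E G)) →
    w (fromℕ k) ≡ w zero ×
    Injective _≡_ _≡_ (w ∘ inject₁) ×
    Injective _≡_ _≡_ f ×
    (∀ i → Joins G (f i) (w (inject₁ i)) (w (suc i))) ×
    (∀ e → (e ∈ C → ∃ λ i → f i ≡ e) × ((∃ λ i → f i ≡ e) → e ∈ C))

-- K_{3,3}: vertices Fin 6 (0,1,2 | 3,4,5), edge (i,j) ↦ combine i j ∈ Fin 9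
K33 : Graph
K33 = record { V = 6 ; E = 9 ; ends = λ e → ends' (remQuot 3 e) }
  where
  ends' : Fin 3 × Fin 3 → Fin 6 × Fin 6
  ends' (i , j) = (i ↑ˡ 3) , (3 ↑ʳ j)

K33Circuit : Subset 9 → Set
K33Circuit = IsCycleEdgeSet K33

-- N \ a ≅ M(K_{3,3}): a bijection φ : Fin 9 → E(N) - a carrying circuits
-- to circuits (stated via preimages, φ being a bijection onto E(N) - a).

preimage : ∀ {m n} → (Fin m → Fin n) → Subset n → Subset m
preimage φ X = tabulate (λ i → lookup X (φ i))

DelIsoK33 : ∀ {n} → Matroid n → Fin n → Set
DelIsoK33 {n} N a = ∃ λ (φ : Fin 9 → Fin n) →
  Injective _≡_ _≡_ φ ×
  (∀ i → φ i ≢ a) ×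
  (∀ x → x ≢ a → ∃ λ i → φ i ≡ x) ×
  (∀ X → a ∉ X →
     (DelCircuit N a X → K33Circuit (preimage φ X)) ×
     (K33Circuit (preimage φ X) → DelCircuit N a X))

{-# OPTIONS --safe #-}
module Submission where

-- N ∖ a is the cycle matroid of K₃,₃, a bipartite graph without parallel edges, so
-- every circuit of N avoiding a has even size different from 2. In a binary
-- representation of N, every zero-sum set avoiding a is a disjoint union of such
-- circuits and therefore even as well. Now let C₁ - a and C₂ - a be circuits of N / a
-- of sizes 2 and odd. If a ∉ Cᵢ, then Cᵢ itself is a circuit of N ∖ a, which is
-- impossible for either size. Otherwise both Cᵢ - a sum to the vector of a, so their
-- symmetric difference is a zero-sum set avoiding a of odd size.

open import Defs
open import Data.Nat using (ℕ; _%_)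
open import Data.Fin using (Fin)
open import Data.Fin.Subset using (_∈_; _∉_; ∣_∣)
open import Data.Product using (∃; _×_)
open import Relation.Binary.PropositionalEquality using (_≡_)
open import Relation.Nullary using (¬_)

open import Algebra.Bundles using (AbelianGroup)
import Algebra.Properties.AbelianGroup as AbelianGroupProperties
import Algebra.Properties.CommutativeSemigroup as CommutativeSemigroupProperties
open import Data.Bool using (Bool; true; false; _xor_; if_then_else_)
import Data.Bool as Bool
open import Data.Bool.Properties using (xor-assoc; xor-comm; xor-identityˡ; xor-identityʳ; xor-same)
open import Data.Empty using (⊥; ⊥-elim)
open import Data.Fin using (zero; suc; inject₁; fromℕ; _↑ˡ_; remQuot; combine)
open import Data.Fin.Properties using (suc-injective; ↑ˡ-injective; ↑ʳ-injective; combine-remQuot)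
open import Data.Fin.Subset using (Subset; ⊤; _⊆_; _⊂_; _-_; _─_; Nonempty)
open import Data.Fin.Subset.Induction using (Acc; acc; ⊂-wellFounded)
open import Data.Fin.Subset.Properties
  using (Empty-unique; ∣⊥∣≡0; ∣⊤∣≡n; ∈⊤; p─⊥≡p; p─q⊆p; x∈p∧x≢y⇒x∈p-y; ⊆-antisym; drop-there;
         anySubset?; nonempty?; _⊂?_; _∈?_)
open import Data.Nat using (suc; parity)
open import Data.Parity using (Parity; 0ℙ; 1ℙ; _⁻¹; _+_)
open import Data.Parity.Properties as ℙ using (+-homo-+; +-cancelʳ-≡; +-identityʳ; p≢p⁻¹)
open import Data.Product using (_,_; proj₁; proj₂; uncurry)
import Data.Product as Product
open import Data.Sum using (inj₁; inj₂; _⊎_)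
import Data.Sum as Sum
open import Data.Vec using (Vec; []; _∷_; zipWith; lookup; here; there)
open import Data.Vec.Properties
  using (zipWith-assoc; zipWith-comm; zipWith-identityˡ; zipWith-identityʳ; []=⇒lookup; lookup⇒[]=;
         lookup∘tabulate; ≡-dec)
open import Function using (_∘_; id; case_of_; Injective)
open import Level using (0ℓ)
open import Relation.Binary.PropositionalEquality
  using (_≢_; refl; sym; trans; cong; cong₂; subst; isEquivalence; module ≡-Reasoning)
open import Relation.Nullary using (Dec; yes; no)
open import Relation.Nullary.Decidable using (_×-dec_)
open ≡-Reasoning

⊕-self : ∀ {r} (x : Vec Bool r) → x ⊕ x ≡ zeroV
⊕-self [] = refl
⊕-self (b ∷ x) = cong₂ _∷_ (xor-same b) (⊕-self x)

⊕-abelianGroup : ℕ → AbelianGroup 0ℓ 0ℓ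
⊕-abelianGroup r = record
  { Carrier = Vec Bool r
  ; _≈_ = _≡_
  ; _∙_ = _⊕_
  ; ε = zeroV
  ; _⁻¹ = id
  ; isAbelianGroup = record
    { isGroup = record
      { isMonoid = record
        { isSemigroup = record
          { isMagma = record { isEquivalence = isEquivalence ; ∙-cong = cong₂ _⊕_ }
          ; assoc = zipWith-assoc xor-assoc
          }
        ; identity = zipWith-identityˡ xor-identityˡ , zipWith-identityʳ xor-identityʳ
        }
      ; inverse = ⊕-self , ⊕-self
      ; ⁻¹-cong = id
      }
    ; comm = zipWith-comm xor-comm
    }
  }

module ⊕-Properties {r : ℕ} where
  open AbelianGroup (⊕-abelianGroup r) public
    using ()
    renaming (identityˡ to ⊕-identityˡ; identityʳ to ⊕-identityʳ; comm to ⊕-comm; assoc to ⊕-assoc)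
  open AbelianGroupProperties (⊕-abelianGroup r) public
    using () renaming (inverseˡ-unique to ⊕≡zero⇒≡)
  open CommutativeSemigroupProperties (AbelianGroup.commutativeSemigroup (⊕-abelianGroup r))
    public using () renaming (interchange to ⊕-interchange)

open ⊕-Properties

-- Scalar multiplication, in the form in which it occurs in the definition of sumOver.
infixr 25 _·_

_·_ : ∀ {r} → Bool → Vec Bool r → Vec Bool r
b · u = if b then u else zeroV

·-distribʳ-xor : ∀ {r} x y (u : Vec Bool r) → (x xor y) · u ≡ x · u ⊕ y · u
·-distribʳ-xor true true u = sym (⊕-self u)
·-distribʳ-xor true false u = sym (⊕-identityʳ u)
·-distribʳ-xor false true u = sym (⊕-identityˡ u)
·-distribʳ-xor false false u = sym (⊕-identityˡ zeroV)

infixl 6 _Δ_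

_Δ_ : ∀ {n} → Subset n → Subset n → Subset n
_Δ_ = zipWith _xor_

∈Δ⁻ : ∀ {n} (p q : Subset n) {x} → x ∈ p Δ q → (x ∈ p × x ∉ q) ⊎ (x ∉ p × x ∈ q)
∈Δ⁻ (true ∷ p) (false ∷ q) here = inj₁ (here , λ ())
∈Δ⁻ (false ∷ p) (true ∷ q) here = inj₂ ((λ ()) , here)
∈Δ⁻ (_ ∷ p) (_ ∷ q) (there x∈pΔq) =
  Sum.map (Product.map there (_∘ drop-there)) (Product.map (_∘ drop-there) there)
          (∈Δ⁻ p q x∈pΔq)

x∉p∧x∉q⇒x∉pΔq : ∀ {n} {p q : Subset n} {x} → x ∉ p → x ∉ q → x ∉ p Δ q
x∉p∧x∉q⇒x∉pΔq {p = p} {q} x∉p x∉q x∈pΔq =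
  Sum.[ x∉p ∘ proj₁ , x∉q ∘ proj₂ ] (∈Δ⁻ p q x∈pΔq)

q≢∅∧q⊆p⇒pΔq⊂p : ∀ {n} {p q : Subset n} → Nonempty q → q ⊆ p → p Δ q ⊂ p
q≢∅∧q⊆p⇒pΔq⊂p {p = p} {q} (x , x∈q) q⊆p = pΔq⊆p , x , q⊆p x∈q , x∉pΔq
  where
  pΔq⊆p : p Δ q ⊆ p
  pΔq⊆p y∈pΔq =
    Sum.[ proj₁ , (λ (y∉p , y∈q) → ⊥-elim (y∉p (q⊆p y∈q))) ] (∈Δ⁻ p q y∈pΔq)
  x∉pΔq : x ∉ p Δ q
  x∉pΔq x∈pΔq =
    Sum.[ (λ (_ , x∉q) → x∉q x∈q) , (λ (x∉p , _) → x∉p (q⊆p x∈q)) ] (∈Δ⁻ p q x∈pΔq)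

x∉p-x : ∀ {n} (p : Subset n) x → x ∉ p - x
x∉p-x (_ ∷ p) (suc x) (there x∈p-x) = x∉p-x p x x∈p-x

x∈p-y⇒x≢y : ∀ {n} {p : Subset n} {x y} → x ∈ p - y → x ≢ y
x∈p-y⇒x≢y {p = p} x∈p-x refl = x∉p-x p _ x∈p-x

x∉p⇒p-x≡p : ∀ {n} {p : Subset n} {x} → x ∉ p → p - x ≡ p
x∉p⇒p-x≡p {p = p} x∉p =
  ⊆-antisym (p─q⊆p p _) (λ y∈p → x∈p∧x≢y⇒x∈p-y y∈p (λ { refl → x∉p y∈p }))

x∈p⇒∣p∣≡1+∣p-x∣ : ∀ {n} {p : Subset n} {x} → x ∈ p → ∣ p ∣ ≡ suc ∣ p - x ∣
x∈p⇒∣p∣≡1+∣p-x∣ {p = true ∷ p} here = cong (suc ∘ ∣_∣) (sym (p─⊥≡p p))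
x∈p⇒∣p∣≡1+∣p-x∣ {p = true ∷ p} (there x∈p) = cong suc (x∈p⇒∣p∣≡1+∣p-x∣ x∈p)
x∈p⇒∣p∣≡1+∣p-x∣ {p = false ∷ p} (there x∈p) = x∈p⇒∣p∣≡1+∣p-x∣ x∈p

∣f[Z]∣≡∣Z∣ : ∀ {k m} {f : Fin k → Fin m} → Injective _≡_ _≡_ f → ∀ (Z : Subset k) (Y : Subset m) →
             (∀ {y} → y ∈ Y → ∃ λ i → i ∈ Z × f i ≡ y) → (∀ {i} → i ∈ Z → f i ∈ Y) →
             ∣ Y ∣ ≡ ∣ Z ∣
∣f[Z]∣≡∣Z∣ {m = m} f-inj [] Y Y⊆f[Z] _ =
  trans (cong ∣_∣ (Empty-unique (λ (_ , y∈Y) → case Y⊆f[Z] y∈Y of λ ()))) (∣⊥∣≡0 m)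
∣f[Z]∣≡∣Z∣ {f = f} f-inj (false ∷ Z) Y Y⊆f[Z] f[Z]⊆Y =
  ∣f[Z]∣≡∣Z∣ (suc-injective ∘ f-inj) Z Y Y⊆f[sucZ] (f[Z]⊆Y ∘ there)
  where
  Y⊆f[sucZ] : ∀ {y} → y ∈ Y → ∃ λ i → i ∈ Z × f (suc i) ≡ y
  Y⊆f[sucZ] y∈Y with Y⊆f[Z] y∈Y
  ... | suc i , there i∈Z , fi≡y = i , i∈Z , fi≡y
∣f[Z]∣≡∣Z∣ {f = f} f-inj (true ∷ Z) Y Y⊆f[Z] f[Z]⊆Y =
  trans (x∈p⇒∣p∣≡1+∣p-x∣ (f[Z]⊆Y here))
        (cong suc (∣f[Z]∣≡∣Z∣ (suc-injective ∘ f-inj) Z (Y - f zero) Y-f0⊆f[sucZ] f[sucZ]⊆Y-f0))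
  where
  Y-f0⊆f[sucZ] : ∀ {y} → y ∈ Y - f zero → ∃ λ i → i ∈ Z × f (suc i) ≡ y
  Y-f0⊆f[sucZ] y∈Y-f0 with Y⊆f[Z] (p─q⊆p Y _ y∈Y-f0)
  ... | zero , _ , f0≡y = ⊥-elim (x∈p-y⇒x≢y y∈Y-f0 (sym f0≡y))
  ... | suc i , there i∈Z , fi≡y = i , i∈Z , fi≡y
  f[sucZ]⊆Y-f0 : ∀ {i} → i ∈ Z → f (suc i) ∈ Y - f zero
  f[sucZ]⊆Y-f0 i∈Z =
    x∈p∧x≢y⇒x∈p-y (f[Z]⊆Y (there i∈Z)) (λ f-suc≡f0 → case f-inj f-suc≡f0 of λ ())

∈-preimage⁺ : ∀ {m n} (φ : Fin m → Fin n) (X : Subset n) {i} → φ i ∈ X → i ∈ preimage φ X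
∈-preimage⁺ φ X {i} φi∈X =
  lookup⇒[]= i (preimage φ X) (trans (lookup∘tabulate (lookup X ∘ φ) i) ([]=⇒lookup φi∈X))

∈-preimage⁻ : ∀ {m n} (φ : Fin m → Fin n) (X : Subset n) {i} → i ∈ preimage φ X → φ i ∈ X
∈-preimage⁻ φ X {i} i∈φ⁻¹X =
  lookup⇒[]= (φ i) X (trans (sym (lookup∘tabulate (lookup X ∘ φ) i)) ([]=⇒lookup i∈φ⁻¹X))

∣φ⁻¹X∣≡∣X∣ : ∀ {m n} {φ : Fin m → Fin n} → Injective _≡_ _≡_ φ → ∀ X →
              (∀ {x} → x ∈ X → ∃ λ i → φ i ≡ x) → ∣ preimage φ X ∣ ≡ ∣ X ∣
∣φ⁻¹X∣≡∣X∣ {φ = φ} φ-inj X X⊆φ[Fin] =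
  sym (∣f[Z]∣≡∣Z∣ φ-inj (preimage φ X) X X⊆φ[φ⁻¹X] (∈-preimage⁻ φ X))
  where
  X⊆φ[φ⁻¹X] : ∀ {x} → x ∈ X → ∃ λ i → i ∈ preimage φ X × φ i ≡ x
  X⊆φ[φ⁻¹X] x∈X with X⊆φ[Fin] x∈X
  ... | i , refl = i , ∈-preimage⁺ φ X x∈X , refl

bitParity : Bool → Parity
bitParity false = 0ℙ
bitParity true = 1ℙ

bitParity-xor : ∀ x y → bitParity (x xor y) ≡ bitParity x + bitParity y
bitParity-xor false y = refl
bitParity-xor true false = refl
bitParity-xor true true = refl

parity-∣∷∣ : ∀ {n} b (p : Subset n) → parity ∣ b ∷ p ∣ ≡ bitParity b + parity ∣ p ∣
parity-∣∷∣ false p = refl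
parity-∣∷∣ true p = +-homo-+ 1 ∣ p ∣

parity-∣Δ∣ : ∀ {n} (p q : Subset n) → parity ∣ p Δ q ∣ ≡ parity ∣ p ∣ + parity ∣ q ∣
parity-∣Δ∣ [] [] = refl
parity-∣Δ∣ (x ∷ p) (y ∷ q) = begin
  parity ∣ (x xor y) ∷ p Δ q ∣
    ≡⟨ parity-∣∷∣ (x xor y) (p Δ q) ⟩
  bitParity (x xor y) + parity ∣ p Δ q ∣
    ≡⟨ cong₂ _+_ (bitParity-xor x y) (parity-∣Δ∣ p q) ⟩
  (bitParity x + bitParity y) + (parity ∣ p ∣ + parity ∣ q ∣)
    ≡⟨ ℙ-interchange (bitParity x) (bitParity y) (parity ∣ p ∣) (parity ∣ q ∣) ⟩
  (bitParity x + parity ∣ p ∣) + (bitParity y + parity ∣ q ∣)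
    ≡⟨ sym (cong₂ _+_ (parity-∣∷∣ x p) (parity-∣∷∣ y q)) ⟩
  parity ∣ x ∷ p ∣ + parity ∣ y ∷ q ∣ ∎
  where
  open CommutativeSemigroupProperties ℙ.+-commutativeSemigroup
    using () renaming (interchange to ℙ-interchange)

%2≡1⇒parity≡1ℙ : ∀ m → m % 2 ≡ 1 → parity m ≡ 1ℙ
%2≡1⇒parity≡1ℙ 1 _ = refl
%2≡1⇒parity≡1ℙ (suc (suc m)) m%2≡1 = %2≡1⇒parity≡1ℙ m m%2≡1

alternating-parity : ∀ k (s : Fin (suc k) → Parity) → (∀ i → s (suc i) ≡ s (inject₁ i) ⁻¹) →
                     s (fromℕ k) ≡ parity k + s zero
alternating-parity 0 s _ = refl
alternating-parity (suc k) s flips = begin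
  s (suc (fromℕ k))         ≡⟨ flips (fromℕ k) ⟩
  s (inject₁ (fromℕ k)) ⁻¹  ≡⟨ cong _⁻¹ (alternating-parity k (s ∘ inject₁) (flips ∘ inject₁)) ⟩
  1ℙ + (parity k + s zero)  ≡⟨ sym (ℙ.+-assoc 1ℙ (parity k) (s zero)) ⟩
  (1ℙ + parity k) + s zero  ≡⟨ cong (_+ s zero) (sym (+-homo-+ 1 k)) ⟩
  parity (suc k) + s zero   ∎

ZeroSum : ∀ {n r} → (Fin n → Vec Bool r) → Subset n → Set
ZeroSum v X = sumOver v X ≡ zeroV

sumOver-Δ : ∀ {n r} (v : Fin n → Vec Bool r) X Y →
            sumOver v (X Δ Y) ≡ sumOver v X ⊕ sumOver v Y
sumOver-Δ v [] [] = sym (⊕-identityˡ zeroV)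
sumOver-Δ v (x ∷ X) (y ∷ Y) = begin
  (x xor y) · v zero ⊕ sumOver (v ∘ suc) (X Δ Y)
    ≡⟨ cong₂ _⊕_ (·-distribʳ-xor x y (v zero)) (sumOver-Δ (v ∘ suc) X Y) ⟩
  (x · v zero ⊕ y · v zero) ⊕ (sumOver (v ∘ suc) X ⊕ sumOver (v ∘ suc) Y)
    ≡⟨ ⊕-interchange _ _ _ _ ⟩
  (x · v zero ⊕ sumOver (v ∘ suc) X) ⊕ (y · v zero ⊕ sumOver (v ∘ suc) Y) ∎

sumOver-remove : ∀ {n r} (v : Fin n → Vec Bool r) {X x} → x ∈ X →
                 sumOver v (X - x) ⊕ v x ≡ sumOver v X
sumOver-remove v {true ∷ X} here = begin
  (zeroV ⊕ sumOver (v ∘ suc) (X ─ _)) ⊕ v zero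
    ≡⟨ cong (λ Y → (zeroV ⊕ sumOver (v ∘ suc) Y) ⊕ v zero) (p─⊥≡p X) ⟩
  (zeroV ⊕ sumOver (v ∘ suc) X) ⊕ v zero
    ≡⟨ cong (_⊕ v zero) (⊕-identityˡ _) ⟩
  sumOver (v ∘ suc) X ⊕ v zero
    ≡⟨ ⊕-comm _ _ ⟩
  v zero ⊕ sumOver (v ∘ suc) X ∎
sumOver-remove v {b ∷ X} (there x∈X) = begin
  (b · v zero ⊕ sumOver (v ∘ suc) (X - _)) ⊕ v (suc _)
    ≡⟨ ⊕-assoc _ _ _ ⟩
  b · v zero ⊕ (sumOver (v ∘ suc) (X - _) ⊕ v (suc _))
    ≡⟨ cong (b · v zero ⊕_) (sumOver-remove (v ∘ suc) x∈X) ⟩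
  b · v zero ⊕ sumOver (v ∘ suc) X ∎

module _ {n r} (v : Fin n → Vec Bool r) where

  vecCircuit⇒zeroSum : ∀ {C} → VecCircuit v C → ZeroSum v C
  vecCircuit⇒zeroSum ((S , S⊆C , S≠∅ , S-zero) , minimal) =
    subst (ZeroSum v) (minimal S S⊆C (S , id , S≠∅ , S-zero)) S-zero

  vecCircuit⇒sumOver[C-x]≡v[x] : ∀ {C x} → VecCircuit v C → x ∈ C →
                                 sumOver v (C - x) ≡ v x
  vecCircuit⇒sumOver[C-x]≡v[x] C-circuit x∈C =
    ⊕≡zero⇒≡ _ _ (trans (sumOver-remove v x∈C) (vecCircuit⇒zeroSum C-circuit))

  ProperZeroSumPart : Subset n → Subset n → Set
  ProperZeroSumPart X T = T ⊂ X × Nonempty T × ZeroSum v T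

  minimalZeroSum⇒vecCircuit : ∀ {X} → Nonempty X → ZeroSum v X → ¬ (∃ (ProperZeroSumPart X)) →
                              VecCircuit v X
  minimalZeroSum⇒vecCircuit {X} X≠∅ X-zero no-proper-part = (X , id , X≠∅ , X-zero) , minimal
    where
    minimal : ∀ D → D ⊆ X → Dependent v D → D ≡ X
    minimal D D⊆X (T , T⊆D , T≠∅ , T-zero) = ⊆-antisym D⊆X X⊆D
      where
      X⊆D : X ⊆ D
      X⊆D {x} x∈X with x ∈? T
      ... | yes x∈T = T⊆D x∈T
      ... | no x∉T =
        ⊥-elim (no-proper-part (T , (D⊆X ∘ T⊆D , x , x∈X , x∉T) , T≠∅ , T-zero))

  -- X is a circuit or the disjoint union of two smaller zero-sum sets T and X Δ T.
  even-circuits⇒even-zeroSums : (a : Fin n) → (∀ C → a ∉ C → VecCircuit v C → parity ∣ C ∣ ≡ 0ℙ) →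
                                ∀ X → a ∉ X → ZeroSum v X → parity ∣ X ∣ ≡ 0ℙ
  even-circuits⇒even-zeroSums a circuit-even X = go X (⊂-wellFounded X)
    where
    properZeroSumPart? : ∀ X T → Dec (ProperZeroSumPart X T)
    properZeroSumPart? X T = T ⊂? X ×-dec nonempty? T ×-dec ≡-dec Bool._≟_ (sumOver v T) zeroV

    go : ∀ X → Acc _⊂_ X → a ∉ X → ZeroSum v X → parity ∣ X ∣ ≡ 0ℙ
    go X (acc smaller) a∉X X-zero with anySubset? (properZeroSumPart? X)
    ... | yes (T , T⊂X@(T⊆X , _) , T≠∅ , T-zero) = begin
      parity ∣ X ∣                       ≡⟨ sym (+-identityʳ _) ⟩
      parity ∣ X ∣ + 0ℙ                  ≡⟨ cong (parity ∣ X ∣ +_) (sym T-even) ⟩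
      parity ∣ X ∣ + parity ∣ T ∣        ≡⟨ sym (parity-∣Δ∣ X T) ⟩
      parity ∣ X Δ T ∣                   ≡⟨ XΔT-even ⟩
      0ℙ                                 ∎
      where
      T-even : parity ∣ T ∣ ≡ 0ℙ
      T-even = go T (smaller T⊂X) (a∉X ∘ T⊆X) T-zero
      XΔT⊂X : X Δ T ⊂ X
      XΔT⊂X = q≢∅∧q⊆p⇒pΔq⊂p T≠∅ T⊆X
      XΔT-zero : ZeroSum v (X Δ T)
      XΔT-zero = trans (sumOver-Δ v X T) (trans (cong₂ _⊕_ X-zero T-zero) (⊕-self zeroV))
      XΔT-even : parity ∣ X Δ T ∣ ≡ 0ℙ
      XΔT-even = go (X Δ T) (smaller XΔT⊂X) (a∉X ∘ proj₁ XΔT⊂X) XΔT-zero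
    ... | no no-proper-part with nonempty? X
    ...   | no X=∅ = cong parity (trans (cong ∣_∣ (Empty-unique X=∅)) (∣⊥∣≡0 n))
    ...   | yes X≠∅ = circuit-even X a∉X (minimalZeroSum⇒vecCircuit X≠∅ X-zero no-proper-part)

module _ (G : Graph) where

  cycle-length : ∀ {C} (c : IsCycleEdgeSet G C) → ∣ C ∣ ≡ proj₁ c
  cycle-length {C} (k , _ , _ , f , _ , _ , f-inj , _ , enumerates) =
    trans (∣f[Z]∣≡∣Z∣ f-inj ⊤ C (λ e∈C → Product.map₂ (∈⊤ ,_) (proj₁ (enumerates _) e∈C))
                                (λ {i} _ → proj₂ (enumerates (f i)) (i , refl)))
          (∣⊤∣≡n k)

  joins-sym : ∀ {e u w} → Joins G e u w → Joins G e w u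
  joins-sym = Sum.swap

  no-parallel-edges⇒no-2-cycle : (∀ {e e′ u w} → Joins G e u w → Joins G e′ u w → e ≡ e′) →
                                  ∀ {C} → IsCycleEdgeSet G C → ∣ C ∣ ≢ 2
  no-parallel-edges⇒no-2-cycle unique-edge c@(_ , _ , w , f , closed , _ , f-inj , joins , _) ∣C∣≡2 =
    two-edge-cycle (trans (sym (cycle-length c)) ∣C∣≡2) w f closed f-inj joins
    where
    two-edge-cycle : ∀ {k} → k ≡ 2 → (w : Fin (suc k) → Fin (V G)) (f : Fin k → Fin (E G)) →
                     w (fromℕ k) ≡ w zero → Injective _≡_ _≡_ f →
                     (∀ i → Joins G (f i) (w (inject₁ i)) (w (suc i))) → ⊥
    two-edge-cycle refl w f closed f-inj joins = case f-inj (unique-edge (joins zero) back) of λ ()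
      where
      back : Joins G (f (suc zero)) (w zero) (w (suc zero))
      back = joins-sym (subst (Joins G (f (suc zero)) (w (suc zero))) closed (joins (suc zero)))

module Bipartite (G : Graph) (side : Fin (V G) → Parity)
                 (side-tail : ∀ e → side (proj₁ (ends G e)) ≡ 0ℙ)
                 (side-head : ∀ e → side (proj₂ (ends G e)) ≡ 1ℙ) where

  joins-flips-side : ∀ {e u w} → Joins G e u w → side w ≡ side u ⁻¹
  joins-flips-side {e} (inj₁ refl) = trans (side-head e) (cong _⁻¹ (sym (side-tail e)))
  joins-flips-side {e} (inj₂ refl) = trans (side-tail e) (cong _⁻¹ (sym (side-head e)))

  cycle-even : ∀ {C} → IsCycleEdgeSet G C → parity ∣ C ∣ ≡ 0ℙ
  cycle-even {C} c@(k , _ , w , _ , closed , _ , _ , joins , _) = begin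
    parity ∣ C ∣  ≡⟨ cong parity (cycle-length G c) ⟩
    parity k      ≡⟨ +-cancelʳ-≡ (side (w zero)) (parity k) 0ℙ k-steps-return ⟩
    0ℙ            ∎
    where
    k-steps-return : parity k + side (w zero) ≡ side (w zero)
    k-steps-return =
      trans (sym (alternating-parity k (side ∘ w) (joins-flips-side ∘ joins))) (cong side closed)

  ends≢swap-ends : ∀ e e′ → ends G e ≢ Product.swap (ends G e′)
  ends≢swap-ends e e′ reversed = p≢p⁻¹ 0ℙ (begin
    0ℙ                        ≡⟨ sym (side-tail e) ⟩
    side (proj₁ (ends G e))   ≡⟨ cong (side ∘ proj₁) reversed ⟩
    side (proj₂ (ends G e′))  ≡⟨ side-head e′ ⟩
    1ℙ                        ∎)

  no-parallel-edges : Injective _≡_ _≡_ (ends G) →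
                      ∀ {e e′ u w} → Joins G e u w → Joins G e′ u w → e ≡ e′
  no-parallel-edges ends-inj (inj₁ p) (inj₁ q) = ends-inj (trans p (sym q))
  no-parallel-edges ends-inj (inj₂ p) (inj₂ q) = ends-inj (trans p (sym q))
  no-parallel-edges _ {e} {e′} (inj₁ p) (inj₂ q) =
    ⊥-elim (ends≢swap-ends e e′ (trans p (cong Product.swap (sym q))))
  no-parallel-edges _ {e} {e′} (inj₂ p) (inj₁ q) =
    ⊥-elim (ends≢swap-ends e′ e (trans q (cong Product.swap (sym p))))

K33-side : Fin 6 → Parity
K33-side zero = 0ℙ
K33-side (suc zero) = 0ℙ
K33-side (suc (suc zero)) = 0ℙ
K33-side _ = 1ℙ

K33-side-↑ˡ : ∀ (i : Fin 3) → K33-side (i ↑ˡ 3) ≡ 0ℙ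
K33-side-↑ˡ zero = refl
K33-side-↑ˡ (suc zero) = refl
K33-side-↑ˡ (suc (suc zero)) = refl

K33-ends-injective : Injective _≡_ _≡_ (ends K33)
K33-ends-injective {e} {e′} ends≡ = begin
  e                                   ≡⟨ sym (combine-remQuot {3} 3 e) ⟩
  uncurry combine (remQuot {3} 3 e)   ≡⟨ cong₂ combine (↑ˡ-injective 3 _ _ (cong proj₁ ends≡))
                                                       (↑ʳ-injective 3 _ _ (cong proj₂ ends≡)) ⟩
  uncurry combine (remQuot {3} 3 e′)  ≡⟨ combine-remQuot {3} 3 e′ ⟩
  e′                                  ∎

open Bipartite K33 K33-side (K33-side-↑ˡ ∘ proj₁ ∘ remQuot {3} 3) (λ _ → refl)
  renaming (cycle-even to K33-cycle-even; no-parallel-edges to K33-no-parallel-edges)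

K33-no-2-cycle : ∀ {C} → K33Circuit C → ∣ C ∣ ≢ 2
K33-no-2-cycle = no-parallel-edges⇒no-2-cycle K33 (K33-no-parallel-edges K33-ends-injective)

module _ {n} (N : Matroid n) (a : Fin n) where

  deletionCircuit⇒K33Circuit : DelIsoK33 N a → ∀ {C} → a ∉ C → Circuit N C →
                               ∃ λ Y → K33Circuit Y × ∣ Y ∣ ≡ ∣ C ∣
  deletionCircuit⇒K33Circuit (φ , φ-inj , _ , φ-onto , φ-circuits) {C} a∉C C-circuit =
    preimage φ C , proj₁ (φ-circuits C a∉C) (a∉C , C-circuit) ,
    ∣φ⁻¹X∣≡∣X∣ φ-inj C (λ x∈C → φ-onto _ (λ { refl → a∉C x∈C }))

  deletionCircuit-even : DelIsoK33 N a → ∀ {C} → a ∉ C → Circuit N C → parity ∣ C ∣ ≡ 0ℙ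
  deletionCircuit-even N∖a≅K33 a∉C C-circuit with deletionCircuit⇒K33Circuit N∖a≅K33 a∉C C-circuit
  ... | _ , Y-circuit , ∣Y∣≡∣C∣ = subst (λ m → parity m ≡ 0ℙ) ∣Y∣≡∣C∣ (K33-cycle-even Y-circuit)

  deletionCircuit-∣∣≢2 : DelIsoK33 N a → ∀ {C} → a ∉ C → Circuit N C → ∣ C ∣ ≢ 2
  deletionCircuit-∣∣≢2 N∖a≅K33 a∉C C-circuit with deletionCircuit⇒K33Circuit N∖a≅K33 a∉C C-circuit
  ... | _ , Y-circuit , ∣Y∣≡∣C∣ = K33-no-2-cycle Y-circuit ∘ trans ∣Y∣≡∣C∣

  parity∣C₁-a∣≡parity∣C₂-a∣ : Binary N → DelIsoK33 N a → ∀ {C₁ C₂} → Circuit N C₁ → Circuit N C₂ →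
                              a ∈ C₁ → a ∈ C₂ → parity ∣ C₁ - a ∣ ≡ parity ∣ C₂ - a ∣
  parity∣C₁-a∣≡parity∣C₂-a∣ (_ , v , represents) N∖a≅K33 {C₁} {C₂} C₁-circuit C₂-circuit a∈C₁ a∈C₂ =
    ℙ-inverseˡ-unique _ _ (begin
      parity ∣ C₁ - a ∣ + parity ∣ C₂ - a ∣
        ≡⟨ sym (parity-∣Δ∣ (C₁ - a) (C₂ - a)) ⟩
      parity ∣ X ∣
        ≡⟨ even-circuits⇒even-zeroSums v a avoiding-a-even X a∉X X-zero ⟩
      0ℙ ∎)
    where
    open AbelianGroupProperties ℙ.+-0-abelianGroup
      using () renaming (inverseˡ-unique to ℙ-inverseˡ-unique)
    sumOver[C-a]≡v[a] : ∀ {C} → Circuit N C → a ∈ C → sumOver v (C - a) ≡ v a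
    sumOver[C-a]≡v[a] {C} = vecCircuit⇒sumOver[C-x]≡v[x] v ∘ proj₁ (represents C)
    avoiding-a-even : ∀ C → a ∉ C → VecCircuit v C → parity ∣ C ∣ ≡ 0ℙ
    avoiding-a-even C a∉C = deletionCircuit-even N∖a≅K33 a∉C ∘ proj₂ (represents C)
    X : Subset n
    X = (C₁ - a) Δ (C₂ - a)
    a∉X : a ∉ X
    a∉X = x∉p∧x∉q⇒x∉pΔq (x∉p-x C₁ a) (x∉p-x C₂ a)
    X-zero : ZeroSum v X
    X-zero = begin
      sumOver v X                              ≡⟨ sumOver-Δ v (C₁ - a) (C₂ - a) ⟩
      sumOver v (C₁ - a) ⊕ sumOver v (C₂ - a)  ≡⟨ cong₂ _⊕_ (sumOver[C-a]≡v[a] C₁-circuit a∈C₁)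
                                                            (sumOver[C-a]≡v[a] C₂-circuit a∈C₂) ⟩
      v a ⊕ v a                                ≡⟨ ⊕-self (v a) ⟩
      zeroV                                    ∎

lemma3p4 : ∀ {n} (N : Matroid n) (a : Fin n) → Binary N → DelIsoK33 N a →
  ¬ (∃ λ e → ¬ (e ≡ a) × (∃ λ D → ConCircuit N a D × e ∈ D × ∣ D ∣ ≡ 2) ×
     (∃ λ D → ConCircuit N a D × e ∈ D × ∣ D ∣ % 2 ≡ 1))
lemma3p4 N a N-binary N∖a≅K33
  (_ , _ , (_ , (_ , (C₁ , C₁-circuit , refl) , _) , _ , ∣C₁-a∣≡2) ,
           (_ , (_ , (C₂ , C₂-circuit , refl) , _) , _ , ∣C₂-a∣%2≡1))
  with a ∈? C₁ | a ∈? C₂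
... | no a∉C₁ | _ =
  deletionCircuit-∣∣≢2 N a N∖a≅K33 a∉C₁ C₁-circuit
    (trans (cong ∣_∣ (sym (x∉p⇒p-x≡p a∉C₁))) ∣C₁-a∣≡2)
... | yes _ | no a∉C₂ = p≢p⁻¹ 0ℙ (begin
  0ℙ                 ≡⟨ sym (deletionCircuit-even N a N∖a≅K33 a∉C₂ C₂-circuit) ⟩
  parity ∣ C₂ ∣      ≡⟨ cong (parity ∘ ∣_∣) (sym (x∉p⇒p-x≡p a∉C₂)) ⟩
  parity ∣ C₂ - a ∣  ≡⟨ %2≡1⇒parity≡1ℙ ∣ C₂ - a ∣ ∣C₂-a∣%2≡1 ⟩
  1ℙ                 ∎)
... | yes a∈C₁ | yes a∈C₂ = p≢p⁻¹ 0ℙ (begin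
  0ℙ                 ≡⟨ cong parity (sym ∣C₁-a∣≡2) ⟩
  parity ∣ C₁ - a ∣  ≡⟨ parity∣C₁-a∣≡parity∣C₂-a∣ N a N-binary N∖a≅K33
                          C₁-circuit C₂-circuit a∈C₁ a∈C₂ ⟩
  parity ∣ C₂ - a ∣  ≡⟨ %2≡1⇒parity≡1ℙ ∣ C₂ - a ∣ ∣C₂-a∣%2≡1 ⟩
  1ℙ                 ∎)
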